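{- Let $f:W_{\mathrm{af}}\to S$ (extended $\mathbb{Z}$-linearly to $\mathbb{Z}[W_{\mathrm{af}}]$) satisfy: (i) $f(s_\alpha t_{k\alpha^\vee}w)-f(w)\in\alpha S$ for all $\alpha\in\Phi$, $k\in\mathbb{Z}$, $w\in W_{\mathrm{af}}$; (ii) $f\big((1-t_{\alpha^\vee})^dw\big)\in\alpha^dS$ for all $d\in\mathbb{Z}_{>0}$, $w\in W_{\mathrm{af}}$, $\alpha\in\Phi$; and (iii) $f(wu)=f(w)$ for all $w\in W_{\mathrm{af}}$ and $u\in W$. Then $$f\big((1-t_{\alpha^\vee})^{d-1}(1-s_\alpha)w\big)\in\alpha^dS$$ for all $d\in\mathbb{Z}_{>0}$, $w\in W_{\mathrm{af}}$ and $\alpha\in\Phi$.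
   Context: Fix an irreducible finite root datum with weight lattice $X$, root system $\Phi\subset X$, coroots $\alpha^\vee$, reflections $s_\alpha$, coroot lattice $Q^\vee$ and finite Weyl group $W$. Let $S=\mathrm{Sym}(X)$. The affine Weyl group is $W_{\mathrm{af}}=W\ltimes Q^\vee$ with translations $t_\mu$ ($\mu\in Q^\vee$), $t_\lambda t_\mu=t_{\lambda+\mu}$, $wt_\mu w^{ -1}=t_{w\mu}$ for $w\in W$. The affine real roots are $\alpha+k\delta$ ($\alpha\in\Phi$, $k\in\mathbb{Z}$) with reflections $s_{\alpha+k\delta}=s_\alpha t_{k\alpha^\vee}$, so condition (i) is the GKM condition $f(s_\beta w)-f(w)\in\pi(\beta)S$ where $\pi(\alpha+k\delta)=\alpha$. -}

module Defs where

open import Data.Nat as ℕ using (ℕ; zero; suc)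
open import Data.Integer as ℤ using (ℤ; +_; -_)
open import Data.Fin as Fin using (Fin)
open import Data.Vec as Vec using (Vec; zipWith; tabulate; replicate)
open import Data.Vec.Properties using (≡-dec)
open import Data.List as List using (List; []; _∷_; _++_; map; concatMap; foldr)
open import Data.Product using (Σ; ∃; _×_; _,_)
open import Data.Sum using (_⊎_)
open import Data.Bool using (Bool; true; false)
open import Relation.Nullary using (yes; no)
open import Relation.Binary.PropositionalEquality using (_≡_)

-- Lattices: X = ℤⁿ (weights), X^∨ = ℤⁿ (coweights), standard pairing.

ZVec : ℕ → Set
ZVec n = Vec ℤ n

⟨_,_⟩ : ∀ {n} → ZVec n → ZVec n → ℤ
⟨ x , y ⟩ = Vec.foldr _ ℤ._+_ (+ 0) (zipWith ℤ._*_ x y)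

_+V_ : ∀ {n} → ZVec n → ZVec n → ZVec n
_+V_ = zipWith ℤ._+_

_·V_ : ∀ {n} → ℤ → ZVec n → ZVec n
c ·V v = Vec.map (c ℤ.*_) v

reflX : ∀ {n} → ZVec n → ZVec n → ZVec n → ZVec n
reflX α α∨ x = x +V ((- ⟨ x , α∨ ⟩) ·V α)

reflX∨ : ∀ {n} → ZVec n → ZVec n → ZVec n → ZVec n
reflX∨ α α∨ λ′ = λ′ +V ((- ⟨ α , λ′ ⟩) ·V α∨)

-- Finite root datum (Springer's axioms), with X = ℤⁿ, X^∨ = ℤⁿ,
-- Φ = {root i | i : Fin m}, Φ^∨ = {coroot i}, bijection root i ↦ coroot i.

record RootDatum (n m : ℕ) : Set where
  field
    root   : Fin m → ZVec n
    coroot : Fin m → ZVec n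
    root-inj   : ∀ i j → root i ≡ root j → i ≡ j
    coroot-inj : ∀ i j → coroot i ≡ coroot j → i ≡ j
    pair-two   : ∀ i → ⟨ root i , coroot i ⟩ ≡ + 2
    refl-closed   : ∀ i j → ∃ λ k → root k ≡ reflX (root i) (coroot i) (root j)
    corefl-closed : ∀ i j → ∃ λ k → coroot k ≡ reflX∨ (root i) (coroot i) (coroot j)

Irreducible : ∀ {n m} → RootDatum n m → Set
Irreducible {n} {m} R =
  (Σ (Fin m) λ _ → Fin m) ×
  ((P : Fin m → Bool) →
     (∀ i j → P i ≡ true → P j ≡ false →
        ⟨ RootDatum.root R i , RootDatum.coroot R j ⟩ ≡ + 0) →
     (∀ i → P i ≡ true) ⊎ (∀ i → P i ≡ false))

-- S = Sym(X) = ℤ[x₁,…,xₙ].  A polynomial is a finite formal sum of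
-- (exponent vector, coefficient); equality is equality of all coefficients.

Monomial : ℕ → Set
Monomial n = Vec ℕ n

Poly : ℕ → Set
Poly n = List (Monomial n × ℤ)

coeff : ∀ {n} → Poly n → Monomial n → ℤ
coeff [] e = + 0
coeff ((e′ , c) ∷ p) e with ≡-dec ℕ._≟_ e′ e
... | yes _ = c ℤ.+ coeff p e
... | no _  = coeff p e

_≈P_ : ∀ {n} → Poly n → Poly n → Set
p ≈P q = ∀ e → coeff p e ≡ coeff q e

0P : ∀ {n} → Poly n
0P = []

1P : ∀ {n} → Poly n
1P {n} = (replicate n 0 , + 1) ∷ []

_+P_ : ∀ {n} → Poly n → Poly n → Poly n
_+P_ = _++_

scaleP : ∀ {n} → ℤ → Poly n → Poly n
scaleP c = map (λ { (e , a) → (e , c ℤ.* a) })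

_-P_ : ∀ {n} → Poly n → Poly n → Poly n
p -P q = p +P scaleP (- (+ 1)) q

_*P_ : ∀ {n} → Poly n → Poly n → Poly n
p *P q = concatMap (λ { (e , a) → map (λ { (e′ , b) → (zipWith ℕ._+_ e e′ , a ℤ.* b) }) q }) p

_^P_ : ∀ {n} → Poly n → ℕ → Poly n
p ^P zero  = 1P
p ^P suc d = p *P (p ^P d)

-- the image of x ∈ X in Sym¹(X):  Σ_k x_k · X_k
linP : ∀ {n} → ZVec n → Poly n
linP {n} x = Vec.toList (tabulate λ k →
  (tabulate (λ j → unit j k) , Vec.lookup x k))
  where
  unit : Fin n → Fin n → ℕ
  unit j k with j Fin.≟ k
  ... | yes _ = 1
  ... | no _  = 0

_∈_S : ∀ {n} → Poly n → Poly n → Set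
p ∈ q S = Σ (Poly _) λ r → p ≈P (q *P r)

-- Affine Weyl group W_af = W ⋉ Q^∨, realised faithfully as the group of
-- affine transformations of X^∨ generated by the affine reflections
-- s_α t_{kα^∨} :  λ ↦ s_α(λ + kα^∨) = λ - (⟨α,λ⟩ + k) α^∨.
-- An element is a word (list of generators (i , k) standing for
-- s_{α_i} t_{k α_i^∨}), product = concatenation, and two words are equal
-- in W_af iff they act identically on X^∨.

module WithDatum {n m : ℕ} (R : RootDatum n m) where
  open RootDatum R

  Gen : Set
  Gen = Fin m × ℤ

  Waf : Set
  Waf = List Gen

  actGen : Gen → ZVec n → ZVec n
  actGen (i , k) λ′ = λ′ +V ((- (⟨ root i , λ′ ⟩ ℤ.+ k)) ·V coroot i)

  act : Waf → ZVec n → ZVec n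
  act []       λ′ = λ′
  act (g ∷ gs) λ′ = actGen g (act gs λ′)

  _≈W_ : Waf → Waf → Set
  u ≈W v = ∀ λ′ → act u λ′ ≡ act v λ′

  sα-tk : Fin m → ℤ → Waf
  sα-tk i k = (i , k) ∷ []

  sα : Fin m → Waf
  sα i = sα-tk i (+ 0)

  -- t_{α^∨} = s_α · (s_α t_{α^∨})
  tα∨ : Fin m → Waf
  tα∨ i = (i , + 0) ∷ (i , + 1) ∷ []

  fromW : List (Fin m) → Waf
  fromW = map (λ i → (i , + 0))

  ZWaf : Set
  ZWaf = List (ℤ × Waf)

  ⟦_⟧ : Waf → ZWaf
  ⟦ w ⟧ = (+ 1 , w) ∷ []

  1G : ZWaf
  1G = ⟦ [] ⟧

  _-G_ : ZWaf → ZWaf → ZWaf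
  a -G b = a ++ map (λ { (c , w) → (- c , w) }) b

  _*G_ : ZWaf → ZWaf → ZWaf
  a *G b = concatMap (λ { (c , u) → map (λ { (c′ , v) → (c ℤ.* c′ , u ++ v) }) b }) a

  _^G_ : ZWaf → ℕ → ZWaf
  a ^G zero  = 1G
  a ^G suc d = a *G (a ^G d)

  linExt : (Waf → Poly n) → ZWaf → Poly n
  linExt f = foldr (λ { (c , w) acc → scaleP c (f w) +P acc }) 0P

  α̂ : Fin m → Poly n
  α̂ i = linP (root i)

-- Put Y = (1 - t_{α^∨})^{d-1} and F(u) = f(Y u). All words of Y are powers of t_{α^∨}, so
-- hypothesis (ii) says F(u) - F(t_{α^∨} u) ∈ α^d S, and telescoping extends this to
-- F(u) - F(t_{jα^∨} u) ∈ α^d S for every j ∈ ℤ. Write w = t_τ u with u ∈ W; then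
-- s_α w = t_{jα^∨} t_τ s_α u with j = -⟨α, τ⟩, so by (iii) the element in question is
-- F(w) - F(s_α w) = F(t_τ) - F(t_{jα^∨} t_τ) ∈ α^d S.
module Submission where

open import Defs
open import Data.Nat as ℕ using (ℕ; zero; suc; _≤_; _∸_; s≤s)
open import Data.Integer as ℤ using (ℤ; +_; -[1+_]; -_; _+_; _*_; _-_)
import Data.Integer.Properties as ℤ
open import Data.Integer.Tactic.RingSolver using (solve-∀)
open import Data.Fin using (Fin)
open import Data.Vec as Vec using ([]; _∷_)
open import Data.Vec.Properties using (≡-dec; zipWith-assoc; zipWith-identityʳ)
open import Data.List as List using (List; []; _∷_; _++_; map)
open import Data.List.Relation.Unary.All as All using (All; []; _∷_)
import Data.List.Relation.Unary.All.Properties as All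
open import Data.List.Properties using (map-++; ++-assoc; ++-identityʳ)
open import Data.Product using (_×_; _,_; proj₂)
open import Relation.Nullary using (yes; no)
open import Relation.Binary.PropositionalEquality
open import Relation.Binary.Bundles using (Setoid)
import Relation.Binary.Reasoning.Setoid as SetoidReasoning

commute-++ : ∀ {A : Set} {x u v : List A} → x ++ u ≡ u ++ x → x ++ v ≡ v ++ x → x ++ (u ++ v) ≡ (u ++ v) ++ x
commute-++ {x = x} {u} {v} xu≡ux xv≡vx = begin
  x ++ (u ++ v)   ≡⟨ ++-assoc x u v ⟨
  (x ++ u) ++ v   ≡⟨ cong (_++ v) xu≡ux ⟩
  (u ++ x) ++ v   ≡⟨ ++-assoc u x v ⟩
  u ++ (x ++ v)   ≡⟨ cong (u ++_) xv≡vx ⟩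
  u ++ (v ++ x)   ≡⟨ ++-assoc u v x ⟨
  (u ++ v) ++ x   ∎
  where open ≡-Reasoning

+V-assoc : ∀ {n} (x y z : ZVec n) → (x +V y) +V z ≡ x +V (y +V z)
+V-assoc = zipWith-assoc ℤ.+-assoc

+V-identityʳ : ∀ {n} (x : ZVec n) → x +V Vec.replicate n (+ 0) ≡ x
+V-identityʳ = zipWith-identityʳ ℤ.+-identityʳ

+V-·V-distrib : ∀ {n} (l c : ZVec n) s t → (l +V (s ·V c)) +V (t ·V c) ≡ l +V ((s + t) ·V c)
+V-·V-distrib [] [] s t = refl
+V-·V-distrib (x ∷ l) (y ∷ c) s t = cong₂ _∷_ (distrib x y s t) (+V-·V-distrib l c s t)
  where
  distrib : ∀ x y s t → (x + s * y) + t * y ≡ x + (s + t) * y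
  distrib = solve-∀

+V-0·V : ∀ {n} (l c : ZVec n) → l +V ((+ 0) ·V c) ≡ l
+V-0·V [] [] = refl
+V-0·V (x ∷ l) (y ∷ c) = cong₂ _∷_ (zero-multiple x y) (+V-0·V l c)
  where
  zero-multiple : ∀ x y → x + + 0 * y ≡ x
  zero-multiple = solve-∀

⟨⟩-+V : ∀ {n} (a x y : ZVec n) → ⟨ a , x +V y ⟩ ≡ ⟨ a , x ⟩ + ⟨ a , y ⟩
⟨⟩-+V [] [] [] = refl
⟨⟩-+V (a ∷ as) (x ∷ xs) (y ∷ ys) = begin
  a * (x + y) + ⟨ as , xs +V ys ⟩                 ≡⟨ cong (λ z → a * (x + y) + z) (⟨⟩-+V as xs ys) ⟩
  a * (x + y) + (⟨ as , xs ⟩ + ⟨ as , ys ⟩)        ≡⟨ distrib a x y _ _ ⟩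
  (a * x + ⟨ as , xs ⟩) + (a * y + ⟨ as , ys ⟩)    ∎
  where
  open ≡-Reasoning
  distrib : ∀ a x y p q → a * (x + y) + (p + q) ≡ (a * x + p) + (a * y + q)
  distrib = solve-∀

⟨⟩-·V : ∀ {n} (a c : ZVec n) s → ⟨ a , s ·V c ⟩ ≡ s * ⟨ a , c ⟩
⟨⟩-·V [] [] s = sym (ℤ.*-zeroʳ s)
⟨⟩-·V (a ∷ as) (c ∷ cs) s = begin
  a * (s * c) + ⟨ as , s ·V cs ⟩   ≡⟨ cong (λ z → a * (s * c) + z) (⟨⟩-·V as cs s) ⟩
  a * (s * c) + s * ⟨ as , cs ⟩    ≡⟨ distrib a s c _ ⟩
  s * (a * c + ⟨ as , cs ⟩)        ∎
  where
  open ≡-Reasoning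
  distrib : ∀ a s c p → a * (s * c) + s * p ≡ s * (a * c + p)
  distrib = solve-∀

-- For a = α and c = α^∨, reflect k is the action of s_α t_{kα^∨} on X^∨ (actGen).
module AffineReflection {n} (a c : ZVec n) where

  reflect : ℤ → ZVec n → ZVec n
  reflect k l = l +V ((- (⟨ a , l ⟩ + k)) ·V c)

  reflect-+V : ∀ k l μ → reflect k (l +V μ) ≡ reflect (+ 0) l +V reflect k μ
  reflect-+V k l μ = begin
    (l +V μ) +V ((- (⟨ a , l +V μ ⟩ + k)) ·V c)
      ≡⟨ cong (λ z → (l +V μ) +V ((- (z + k)) ·V c)) (⟨⟩-+V a l μ) ⟩
    (l +V μ) +V ((- ((⟨ a , l ⟩ + ⟨ a , μ ⟩) + k)) ·V c)
      ≡⟨ regroup l μ c (⟨ a , l ⟩) (⟨ a , μ ⟩) ⟩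
    reflect (+ 0) l +V reflect k μ
      ∎
    where
    open ≡-Reasoning
    regroup : ∀ {n} (l μ c : ZVec n) p q →
      (l +V μ) +V ((- ((p + q) + k)) ·V c) ≡ (l +V ((- (p + + 0)) ·V c)) +V (μ +V ((- (q + k)) ·V c))
    regroup [] [] [] p q = refl
    regroup (x ∷ l) (y ∷ μ) (z ∷ c) p q = cong₂ _∷_ (componentwise x y z p q k) (regroup l μ c p q)
      where
      componentwise : ∀ x y z p q k →
        (x + y) + (- ((p + q) + k)) * z ≡ (x + (- (p + + 0)) * z) + (y + (- (q + k)) * z)
      componentwise = solve-∀

  module _ (a·c≡2 : ⟨ a , c ⟩ ≡ + 2) where

    reflect-translate : ∀ k l t → reflect k (l +V (t ·V c)) ≡ l +V ((t + - ((⟨ a , l ⟩ + t * + 2) + k)) ·V c)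
    reflect-translate k l t = begin
      (l +V (t ·V c)) +V ((- (⟨ a , l +V (t ·V c) ⟩ + k)) ·V c)
        ≡⟨ cong (λ z → (l +V (t ·V c)) +V ((- (z + k)) ·V c)) pairing ⟩
      (l +V (t ·V c)) +V ((- ((⟨ a , l ⟩ + t * + 2) + k)) ·V c)
        ≡⟨ +V-·V-distrib l c t _ ⟩
      l +V ((t + - ((⟨ a , l ⟩ + t * + 2) + k)) ·V c)
        ∎
      where
      open ≡-Reasoning
      pairing : ⟨ a , l +V (t ·V c) ⟩ ≡ ⟨ a , l ⟩ + t * + 2
      pairing = trans (⟨⟩-+V a l (t ·V c)) (cong (λ z → ⟨ a , l ⟩ + z) (trans (⟨⟩-·V a c t) (cong (t *_) a·c≡2)))

    reflect-involutive : ∀ l → reflect (+ 0) (reflect (+ 0) l) ≡ l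
    reflect-involutive l = begin
      reflect (+ 0) (reflect (+ 0) l)   ≡⟨ reflect-translate (+ 0) l (- (⟨ a , l ⟩ + + 0)) ⟩
      l +V ((- (⟨ a , l ⟩ + + 0) + - ((⟨ a , l ⟩ + - (⟨ a , l ⟩ + + 0) * + 2) + + 0)) ·V c)
        ≡⟨ cong (λ s → l +V (s ·V c)) (cancel ⟨ a , l ⟩) ⟩
      l +V ((+ 0) ·V c)                 ≡⟨ +V-0·V l c ⟩
      l                                 ∎
      where
      open ≡-Reasoning
      cancel : ∀ p → (- (p + + 0)) + - ((p + (- (p + + 0)) * + 2) + + 0) ≡ + 0
      cancel = solve-∀

    reflect₀∘reflect₁ : ∀ l → reflect (+ 0) (reflect (+ 1) l) ≡ l +V ((+ 1) ·V c)
    reflect₀∘reflect₁ l = trans (reflect-translate (+ 0) l (- (⟨ a , l ⟩ + + 1))) (cong (λ s → l +V (s ·V c)) (shift ⟨ a , l ⟩))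
      where
      shift : ∀ p → (- (p + + 1)) + - ((p + (- (p + + 1)) * + 2) + + 0) ≡ + 1
      shift = solve-∀

    reflect₁∘reflect₀ : ∀ l → reflect (+ 1) (reflect (+ 0) l) ≡ l +V ((- + 1) ·V c)
    reflect₁∘reflect₀ l = trans (reflect-translate (+ 1) l (- (⟨ a , l ⟩ + + 0))) (cong (λ s → l +V (s ·V c)) (shift ⟨ a , l ⟩))
      where
      shift : ∀ p → (- (p + + 0)) + - ((p + (- (p + + 0)) * + 2) + + 1) ≡ - + 1
      shift = solve-∀

module _ {n : ℕ} where

  coeff-+P : (p q : Poly n) (e : Monomial n) → coeff (p +P q) e ≡ coeff p e + coeff q e
  coeff-+P [] q e = sym (ℤ.+-identityˡ _)
  coeff-+P ((e′ , c) ∷ p) q e with ≡-dec ℕ._≟_ e′ e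
  ... | yes _ = trans (cong (λ z → c + z) (coeff-+P p q e)) (sym (ℤ.+-assoc c _ _))
  ... | no _  = coeff-+P p q e

  coeff-scaleP : (c : ℤ) (p : Poly n) (e : Monomial n) → coeff (scaleP c p) e ≡ c * coeff p e
  coeff-scaleP c [] e = sym (ℤ.*-zeroʳ c)
  coeff-scaleP c ((e′ , a) ∷ p) e with ≡-dec ℕ._≟_ e′ e
  ... | yes _ = trans (cong (λ z → c * a + z) (coeff-scaleP c p e)) (sym (ℤ.*-distribˡ-+ c a _))
  ... | no _  = coeff-scaleP c p e

  coeff--P : (p q : Poly n) (e : Monomial n) → coeff (p -P q) e ≡ coeff p e - coeff q e
  coeff--P p q e = begin
    coeff (p -P q) e                          ≡⟨ coeff-+P p _ e ⟩
    coeff p e + coeff (scaleP (- + 1) q) e    ≡⟨ cong (λ z → coeff p e + z) (coeff-scaleP (- + 1) q e) ⟩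
    coeff p e + - + 1 * coeff q e             ≡⟨ cong (λ z → coeff p e + z) (ℤ.-1*i≡-i _) ⟩
    coeff p e - coeff q e                     ∎
    where open ≡-Reasoning

  -- _≈P_ unfolds to a statement about coeff, from which Agda cannot recover the
  -- polynomials; wrapping it in a record makes them inferable.
  infix 4 _≋_
  record _≋_ (p q : Poly n) : Set where
    constructor coeffwise
    field coeff-≡ : p ≈P q
  open _≋_ public

  ≋-setoid : Setoid _ _
  ≋-setoid = record
    { Carrier       = Poly n
    ; _≈_           = _≋_
    ; isEquivalence = record
      { refl  = coeffwise λ _ → refl
      ; sym   = λ p≋q → coeffwise λ e → sym (coeff-≡ p≋q e)
      ; trans = λ p≋q q≋r → coeffwise λ e → trans (coeff-≡ p≋q e) (coeff-≡ q≋r e)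
      }
    }

  open Setoid ≋-setoid public using () renaming (refl to ≋-refl; sym to ≋-sym; trans to ≋-trans; reflexive to ≋-reflexive)
  module ≋-Reasoning = SetoidReasoning ≋-setoid

  +P-cong : ∀ {p p′ q q′ : Poly n} → p ≋ p′ → q ≋ q′ → p +P q ≋ p′ +P q′
  +P-cong {p} {p′} {q} {q′} p≋p′ q≋q′ = coeffwise λ e → begin
    coeff (p +P q) e          ≡⟨ coeff-+P p q e ⟩
    coeff p e + coeff q e     ≡⟨ cong₂ _+_ (coeff-≡ p≋p′ e) (coeff-≡ q≋q′ e) ⟩
    coeff p′ e + coeff q′ e   ≡⟨ coeff-+P p′ q′ e ⟨
    coeff (p′ +P q′) e        ∎
    where open ≡-Reasoning

  scaleP-cong : ∀ c {p p′ : Poly n} → p ≋ p′ → scaleP c p ≋ scaleP c p′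
  scaleP-cong c {p} {p′} p≋p′ = coeffwise λ e → begin
    coeff (scaleP c p) e    ≡⟨ coeff-scaleP c p e ⟩
    c * coeff p e           ≡⟨ cong (c *_) (coeff-≡ p≋p′ e) ⟩
    c * coeff p′ e          ≡⟨ coeff-scaleP c p′ e ⟨
    coeff (scaleP c p′) e   ∎
    where open ≡-Reasoning

  -P-cong : ∀ {p p′ q q′ : Poly n} → p ≋ p′ → q ≋ q′ → p -P q ≋ p′ -P q′
  -P-cong p≋p′ q≋q′ = +P-cong p≋p′ (scaleP-cong (- + 1) q≋q′)

  ∷-cong : ∀ (m : Monomial n) {a b : ℤ} {p q : Poly n} → a ≡ b → p ≋ q → (m , a) ∷ p ≋ (m , b) ∷ q
  ∷-cong m {a} refl = +P-cong (≋-refl {(m , a) ∷ []})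

  +P-identityʳ : (p : Poly n) → p +P 0P ≋ p
  +P-identityʳ p = ≋-reflexive (++-identityʳ p)

  scaleP-identityˡ : (p : Poly n) → scaleP (+ 1) p ≋ p
  scaleP-identityˡ p = coeffwise λ e → trans (coeff-scaleP (+ 1) p e) (ℤ.*-identityˡ _)

  +P-interchange : (p q r s : Poly n) → (p +P q) +P (r +P s) ≋ (p +P r) +P (q +P s)
  +P-interchange p q r s = coeffwise λ e → begin
    coeff ((p +P q) +P (r +P s)) e
      ≡⟨ trans (coeff-+P (p +P q) _ e) (cong₂ _+_ (coeff-+P p q e) (coeff-+P r s e)) ⟩
    (coeff p e + coeff q e) + (coeff r e + coeff s e)
      ≡⟨ interchange (coeff p e) (coeff q e) (coeff r e) (coeff s e) ⟩
    (coeff p e + coeff r e) + (coeff q e + coeff s e)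
      ≡⟨ trans (coeff-+P (p +P r) _ e) (cong₂ _+_ (coeff-+P p r e) (coeff-+P q s e)) ⟨
    coeff ((p +P r) +P (q +P s)) e
      ∎
    where
    open ≡-Reasoning
    interchange : ∀ a b c d → (a + b) + (c + d) ≡ (a + c) + (b + d)
    interchange = solve-∀

  -P-+P-interchange : (p q r s : Poly n) → (p -P q) +P (r -P s) ≋ (p +P r) -P (q +P s)
  -P-+P-interchange p q r s = coeffwise λ e → begin
    coeff ((p -P q) +P (r -P s)) e
      ≡⟨ trans (coeff-+P (p -P q) _ e) (cong₂ _+_ (coeff--P p q e) (coeff--P r s e)) ⟩
    (coeff p e - coeff q e) + (coeff r e - coeff s e)
      ≡⟨ interchange (coeff p e) (coeff q e) (coeff r e) (coeff s e) ⟩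
    (coeff p e + coeff r e) - (coeff q e + coeff s e)
      ≡⟨ trans (coeff--P (p +P r) _ e) (cong₂ _-_ (coeff-+P p r e) (coeff-+P q s e)) ⟨
    coeff ((p +P r) -P (q +P s)) e
      ∎
    where
    open ≡-Reasoning
    interchange : ∀ a b c d → (a - b) + (c - d) ≡ (a + c) - (b + d)
    interchange = solve-∀

  scaleP--P : (c : ℤ) (p q : Poly n) → scaleP c (p -P q) ≋ scaleP c p -P scaleP c q
  scaleP--P c p q = coeffwise λ e → begin
    coeff (scaleP c (p -P q)) e
      ≡⟨ trans (coeff-scaleP c (p -P q) e) (cong (c *_) (coeff--P p q e)) ⟩
    c * (coeff p e - coeff q e)
      ≡⟨ distrib c (coeff p e) (coeff q e) ⟩
    c * coeff p e - c * coeff q e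
      ≡⟨ trans (coeff--P (scaleP c p) _ e) (cong₂ _-_ (coeff-scaleP c p e) (coeff-scaleP c q e)) ⟨
    coeff (scaleP c p -P scaleP c q) e
      ∎
    where
    open ≡-Reasoning
    distrib : ∀ c a b → c * (a - b) ≡ c * a - c * b
    distrib = solve-∀

  scaleP-scaleP : (c c′ : ℤ) (p : Poly n) → scaleP c (scaleP c′ p) ≋ scaleP (c * c′) p
  scaleP-scaleP c c′ p = coeffwise λ e → begin
    coeff (scaleP c (scaleP c′ p)) e   ≡⟨ trans (coeff-scaleP c (scaleP c′ p) e) (cong (c *_) (coeff-scaleP c′ p e)) ⟩
    c * (c′ * coeff p e)               ≡⟨ ℤ.*-assoc c c′ (coeff p e) ⟨
    (c * c′) * coeff p e               ≡⟨ coeff-scaleP (c * c′) p e ⟨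
    coeff (scaleP (c * c′) p) e        ∎
    where open ≡-Reasoning

  -P-self : (p : Poly n) → p -P p ≋ 0P
  -P-self p = coeffwise λ e → trans (coeff--P p p e) (ℤ.+-inverseʳ (coeff p e))

  -P-telescope : (p q r : Poly n) → (p -P q) +P (q -P r) ≋ p -P r
  -P-telescope p q r = coeffwise λ e → begin
    coeff ((p -P q) +P (q -P r)) e
      ≡⟨ trans (coeff-+P (p -P q) _ e) (cong₂ _+_ (coeff--P p q e) (coeff--P q r e)) ⟩
    (coeff p e - coeff q e) + (coeff q e - coeff r e)
      ≡⟨ telescope (coeff p e) (coeff q e) (coeff r e) ⟩
    coeff p e - coeff r e
      ≡⟨ coeff--P p r e ⟨
    coeff (p -P r) e
      ∎
    where
    open ≡-Reasoning
    telescope : ∀ a b c → (a - b) + (b - c) ≡ a - c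
    telescope = solve-∀

  -P-cancelʳ : (p q r : Poly n) → (p -P r) -P (q -P r) ≋ p -P q
  -P-cancelʳ p q r = coeffwise λ e → begin
    coeff ((p -P r) -P (q -P r)) e
      ≡⟨ trans (coeff--P (p -P r) _ e) (cong₂ _-_ (coeff--P p r e) (coeff--P q r e)) ⟩
    (coeff p e - coeff r e) - (coeff q e - coeff r e)
      ≡⟨ cancel (coeff p e) (coeff q e) (coeff r e) ⟩
    coeff p e - coeff q e
      ≡⟨ coeff--P p q e ⟨
    coeff (p -P q) e
      ∎
    where
    open ≡-Reasoning
    cancel : ∀ a b c → (a - c) - (b - c) ≡ a - b
    cancel = solve-∀

  monomialMul : Monomial n × ℤ → Poly n → Poly n
  monomialMul (m , a) = map (λ { (e′ , b) → (Vec.zipWith ℕ._+_ m e′ , a * b) })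

  *P-distribˡ-+P : (q r s : Poly n) → q *P (r +P s) ≋ (q *P r) +P (q *P s)
  *P-distribˡ-+P [] r s = ≋-refl
  *P-distribˡ-+P (t ∷ q) r s = begin
    monomialMul t (r +P s) +P (q *P (r +P s))
      ≈⟨ +P-cong (≋-reflexive (map-++ _ r s)) (*P-distribˡ-+P q r s) ⟩
    (monomialMul t r +P monomialMul t s) +P ((q *P r) +P (q *P s))
      ≈⟨ +P-interchange (monomialMul t r) (monomialMul t s) (q *P r) (q *P s) ⟩
    (monomialMul t r +P (q *P r)) +P (monomialMul t s +P (q *P s))
      ∎
    where open ≋-Reasoning

  monomialMul-scaleP : ∀ t c (r : Poly n) → monomialMul t (scaleP c r) ≋ scaleP c (monomialMul t r)
  monomialMul-scaleP t c [] = ≋-refl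
  monomialMul-scaleP (m , a) c ((e′ , b) ∷ r) = ∷-cong _ (left-commute a c b) (monomialMul-scaleP (m , a) c r)
    where
    left-commute : ∀ a c b → a * (c * b) ≡ c * (a * b)
    left-commute = solve-∀

  *P-scaleP : (q : Poly n) (c : ℤ) (r : Poly n) → q *P scaleP c r ≋ scaleP c (q *P r)
  *P-scaleP [] c r = ≋-refl
  *P-scaleP (t ∷ q) c r = begin
    monomialMul t (scaleP c r) +P (q *P scaleP c r)
      ≈⟨ +P-cong (monomialMul-scaleP t c r) (*P-scaleP q c r) ⟩
    scaleP c (monomialMul t r) +P scaleP c (q *P r)
      ≡⟨ map-++ _ (monomialMul t r) (q *P r) ⟨
    scaleP c (monomialMul t r +P (q *P r))
      ∎
    where open ≋-Reasoning

  *P-zeroʳ : (q : Poly n) → q *P 0P ≋ 0P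
  *P-zeroʳ [] = ≋-refl
  *P-zeroʳ (_ ∷ q) = *P-zeroʳ q

  -- Membership in the principal ideal q S, wrapped in a record for the same reason as _≋_.
  infix 4 _∈⟨_⟩
  record _∈⟨_⟩ (p q : Poly n) : Set where
    constructor inIdeal
    field membership : p ∈ q S
  open _∈⟨_⟩ public

  module _ {q : Poly n} where

    ∈⟨⟩-resp : ∀ {p p′} → p ≋ p′ → p ∈⟨ q ⟩ → p′ ∈⟨ q ⟩
    ∈⟨⟩-resp p≋p′ (inIdeal (r , p≈qr)) = inIdeal (r , λ e → trans (sym (coeff-≡ p≋p′ e)) (p≈qr e))

    0P-∈⟨⟩ : 0P ∈⟨ q ⟩
    0P-∈⟨⟩ = inIdeal (0P , coeff-≡ (≋-sym (*P-zeroʳ q)))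

    +P-∈⟨⟩ : ∀ {p p′} → p ∈⟨ q ⟩ → p′ ∈⟨ q ⟩ → p +P p′ ∈⟨ q ⟩
    +P-∈⟨⟩ {p} {p′} (inIdeal (r , p≈qr)) (inIdeal (r′ , p′≈qr′)) = inIdeal (r +P r′ , coeff-≡ (begin
      p +P p′                   ≈⟨ +P-cong (coeffwise {p} {q *P r} p≈qr) (coeffwise {p′} {q *P r′} p′≈qr′) ⟩
      (q *P r) +P (q *P r′)     ≈⟨ *P-distribˡ-+P q r r′ ⟨
      q *P (r +P r′)            ∎))
      where open ≋-Reasoning

    scaleP-∈⟨⟩ : ∀ c {p} → p ∈⟨ q ⟩ → scaleP c p ∈⟨ q ⟩
    scaleP-∈⟨⟩ c {p} (inIdeal (r , p≈qr)) = inIdeal (scaleP c r , coeff-≡ (begin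
      scaleP c p          ≈⟨ scaleP-cong c (coeffwise {p} {q *P r} p≈qr) ⟩
      scaleP c (q *P r)   ≈⟨ *P-scaleP q c r ⟨
      q *P scaleP c r     ∎))
      where open ≋-Reasoning

    -P-∈⟨⟩ : ∀ {p p′} → p ∈⟨ q ⟩ → p′ ∈⟨ q ⟩ → p -P p′ ∈⟨ q ⟩
    -P-∈⟨⟩ p∈ p′∈ = +P-∈⟨⟩ p∈ (scaleP-∈⟨⟩ (- + 1) p′∈)

module _ {n m : ℕ} (R : RootDatum n m) where
  open RootDatum R
  open WithDatum R

  leftMul : ℤ × Waf → ZWaf → ZWaf
  leftMul (c , u) = map (λ { (c′ , v) → (c * c′ , u ++ v) })

  module _ (f : Waf → Poly n) where

    linExt-++ : ∀ P Q → linExt f (P ++ Q) ≋ linExt f P +P linExt f Q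
    linExt-++ [] Q = ≋-refl
    linExt-++ ((c , u) ∷ P) Q = begin
      scaleP c (f u) +P linExt f (P ++ Q)                 ≈⟨ +P-cong ≋-refl (linExt-++ P Q) ⟩
      scaleP c (f u) +P (linExt f P +P linExt f Q)        ≡⟨ ++-assoc (scaleP c (f u)) _ _ ⟨
      (scaleP c (f u) +P linExt f P) +P linExt f Q        ∎
      where open ≋-Reasoning

    linExt-⟦⟧ : ∀ w → linExt f ⟦ w ⟧ ≋ f w
    linExt-⟦⟧ w = ≋-trans (+P-identityʳ _) (scaleP-identityˡ (f w))

    linExt-1-⟦⟧ : ∀ y → linExt f (1G -G ⟦ y ⟧) ≋ f [] -P f y
    linExt-1-⟦⟧ y = +P-cong (scaleP-identityˡ (f [])) (+P-identityʳ _)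

    linExt-leftMul : ∀ c u Q → linExt f (leftMul (c , u) Q) ≋ scaleP c (linExt (λ v → f (u ++ v)) Q)
    linExt-leftMul c u [] = ≋-refl
    linExt-leftMul c u ((c′ , v) ∷ Q) = begin
      scaleP (c * c′) (f (u ++ v)) +P linExt f (leftMul (c , u) Q)
        ≈⟨ +P-cong (≋-sym (scaleP-scaleP c c′ (f (u ++ v)))) (linExt-leftMul c u Q) ⟩
      scaleP c (scaleP c′ (f (u ++ v))) +P scaleP c (linExt (λ v → f (u ++ v)) Q)
        ≡⟨ map-++ _ (scaleP c′ (f (u ++ v))) _ ⟨
      scaleP c (scaleP c′ (f (u ++ v)) +P linExt (λ v → f (u ++ v)) Q)
        ∎
      where open ≋-Reasoning

    linExt-*G : ∀ P Q → linExt f (P *G Q) ≋ linExt (λ u → linExt (λ v → f (u ++ v)) Q) P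
    linExt-*G [] Q = ≋-refl
    linExt-*G ((c , u) ∷ P) Q = ≋-trans (linExt-++ (leftMul (c , u) Q) (P *G Q))
                                         (+P-cong (linExt-leftMul c u Q) (linExt-*G P Q))

  linExt-cong-support : ∀ {f g : Waf → Poly n} Z → All (λ cu → f (proj₂ cu) ≋ g (proj₂ cu)) Z → linExt f Z ≋ linExt g Z
  linExt-cong-support [] [] = ≋-refl
  linExt-cong-support ((c , u) ∷ Z) (fu≋gu ∷ eqs) = +P-cong (scaleP-cong c fu≋gu) (linExt-cong-support Z eqs)

  linExt-cong : ∀ {f g : Waf → Poly n} → (∀ u → f u ≋ g u) → ∀ Z → linExt f Z ≋ linExt g Z
  linExt-cong f≋g Z = linExt-cong-support Z (All.tabulate λ {(_ , u)} _ → f≋g u)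

  linExt--P : ∀ (f g : Waf → Poly n) Z → linExt (λ u → f u -P g u) Z ≋ linExt f Z -P linExt g Z
  linExt--P f g [] = ≋-refl
  linExt--P f g ((c , u) ∷ Z) = begin
    scaleP c (f u -P g u) +P linExt (λ u → f u -P g u) Z
      ≈⟨ +P-cong (scaleP--P c (f u) (g u)) (linExt--P f g Z) ⟩
    (scaleP c (f u) -P scaleP c (g u)) +P (linExt f Z -P linExt g Z)
      ≈⟨ -P-+P-interchange (scaleP c (f u)) (scaleP c (g u)) (linExt f Z) (linExt g Z) ⟩
    (scaleP c (f u) +P linExt f Z) -P (scaleP c (g u) +P linExt g Z)
      ∎
    where open ≋-Reasoning

  linExt-*G-⟦⟧ : ∀ f Z u → linExt f (Z *G ⟦ u ⟧) ≋ linExt (λ y → f (y ++ u)) Z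
  linExt-*G-⟦⟧ f Z u = ≋-trans (linExt-*G f Z ⟦ u ⟧)
    (linExt-cong (λ y → linExt-⟦⟧ (λ v → f (y ++ v)) u) Z)

  linExt-1-⟦⟧-*G : ∀ f y Z → linExt f ((1G -G ⟦ y ⟧) *G Z) ≋ linExt f Z -P linExt (λ z → f (y ++ z)) Z
  linExt-1-⟦⟧-*G f y Z = ≋-trans (linExt-*G f (1G -G ⟦ y ⟧) Z) (linExt-1-⟦⟧ (λ u → linExt (λ v → f (u ++ v)) Z) y)

  linExt-*G-1-⟦⟧ : ∀ f Z y → linExt f (Z *G (1G -G ⟦ y ⟧)) ≋ linExt f Z -P linExt (λ z → f (z ++ y)) Z
  linExt-*G-1-⟦⟧ f Z y = begin
    linExt f (Z *G (1G -G ⟦ y ⟧))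
      ≈⟨ linExt-*G f Z (1G -G ⟦ y ⟧) ⟩
    linExt (λ z → linExt (λ v → f (z ++ v)) (1G -G ⟦ y ⟧)) Z
      ≈⟨ linExt-cong (λ z → linExt-1-⟦⟧ (λ v → f (z ++ v)) y) Z ⟩
    linExt (λ z → f (z ++ []) -P f (z ++ y)) Z
      ≈⟨ linExt--P (λ z → f (z ++ [])) (λ z → f (z ++ y)) Z ⟩
    linExt (λ z → f (z ++ [])) Z -P linExt (λ z → f (z ++ y)) Z
      ≈⟨ -P-cong (linExt-cong (λ z → ≋-reflexive (cong f (++-identityʳ z))) Z) ≋-refl ⟩
    linExt f Z -P linExt (λ z → f (z ++ y)) Z
      ∎
    where open ≋-Reasoning

  All-*G : ∀ {P : Waf → Set} → (∀ {u v} → P u → P v → P (u ++ v)) →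
    ∀ A B → All (λ cu → P (proj₂ cu)) A → All (λ cu → P (proj₂ cu)) B → All (λ cu → P (proj₂ cu)) (A *G B)
  All-*G {P} ++-closed [] B [] _ = []
  All-*G {P} ++-closed ((c , u) ∷ A) B (pu ∷ pA) pB = All.++⁺ (row pB) (All-*G ++-closed A B pA pB)
    where
    row : ∀ {B} → All (λ cu → P (proj₂ cu)) B → All (λ cu → P (proj₂ cu)) (leftMul (c , u) B)
    row [] = []
    row (pv ∷ pB) = ++-closed pu pv ∷ row pB

  ^G-commutes : ∀ x d → All (λ cy → x ++ proj₂ cy ≡ proj₂ cy ++ x) ((1G -G ⟦ x ⟧) ^G d)
  ^G-commutes x zero = ++-identityʳ x ∷ []
  ^G-commutes x (suc d) =
    All-*G {λ y → x ++ y ≡ y ++ x} (commute-++ {x = x}) (1G -G ⟦ x ⟧) _ (++-identityʳ x ∷ refl ∷ []) (^G-commutes x d)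

  act-++ : ∀ u v l → act (u ++ v) l ≡ act u (act v l)
  act-++ [] v l = refl
  act-++ (g ∷ u) v l = cong (actGen g) (act-++ u v l)

  ≈W-++ˡ : ∀ y {u v} → u ≈W v → (y ++ u) ≈W (y ++ v)
  ≈W-++ˡ y {u} {v} u≈v l = begin
    act (y ++ u) l     ≡⟨ act-++ y u l ⟩
    act y (act u l)    ≡⟨ cong (act y) (u≈v l) ⟩
    act y (act v l)    ≡⟨ act-++ y v l ⟨
    act (y ++ v) l     ∎
    where open ≡-Reasoning

  infixr 8 _^ʷ_
  _^ʷ_ : Waf → ℕ → Waf
  x ^ʷ zero  = []
  x ^ʷ suc k = x ++ x ^ʷ k

  -- x^j for j : ℤ, given a word x̄ representing x⁻¹.
  zpow : Waf → Waf → ℤ → Waf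
  zpow x x̄ (+ k)    = x ^ʷ k
  zpow x x̄ -[1+ k ] = x̄ ^ʷ suc k

  act-^ʷ : ∀ x c s → (∀ l → act x l ≡ l +V (s ·V c)) → ∀ k l → act (x ^ʷ k) l ≡ l +V ((+ k * s) ·V c)
  act-^ʷ x c s act-x zero l = sym (trans (cong (λ z → l +V (z ·V c)) (ℤ.*-zeroˡ s)) (+V-0·V l c))
  act-^ʷ x c s act-x (suc k) l = begin
    act (x ++ x ^ʷ k) l                   ≡⟨ act-++ x (x ^ʷ k) l ⟩
    act x (act (x ^ʷ k) l)                ≡⟨ act-x _ ⟩
    act (x ^ʷ k) l +V (s ·V c)            ≡⟨ cong (_+V (s ·V c)) (act-^ʷ x c s act-x k l) ⟩
    (l +V ((+ k * s) ·V c)) +V (s ·V c)   ≡⟨ +V-·V-distrib l c (+ k * s) s ⟩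
    l +V ((+ k * s + s) ·V c)             ≡⟨ cong (λ z → l +V (z ·V c)) (successor (+ k) s) ⟩
    l +V ((+ suc k * s) ·V c)             ∎
    where
    open ≡-Reasoning
    successor : ∀ z s → z * s + s ≡ (+ 1 + z) * s
    successor = solve-∀

  module _ {q : Poly n} (g : Waf → Poly n) (g-resp : ∀ {u v} → u ≈W v → g u ≋ g v)
           {x x̄ : Waf} (x-x̄ : ∀ l → act x (act x̄ l) ≡ l)
           (step : ∀ u → g u -P g (x ++ u) ∈⟨ q ⟩) where

    telescope-^ʷ : ∀ k u → g u -P g (x ^ʷ k ++ u) ∈⟨ q ⟩
    telescope-^ʷ zero u = ∈⟨⟩-resp (≋-sym (-P-self (g u))) 0P-∈⟨⟩
    telescope-^ʷ (suc k) u = ∈⟨⟩-resp regroup (+P-∈⟨⟩ (telescope-^ʷ k u) (step (x ^ʷ k ++ u)))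
      where
      regroup : (g u -P g (x ^ʷ k ++ u)) +P (g (x ^ʷ k ++ u) -P g (x ++ (x ^ʷ k ++ u))) ≋ g u -P g (x ^ʷ suc k ++ u)
      regroup = ≋-trans (-P-telescope (g u) _ _) (-P-cong ≋-refl (≋-reflexive (cong g (sym (++-assoc x (x ^ʷ k) u)))))

    telescope-x̄^ʷ : ∀ k u → g u -P g (x̄ ^ʷ k ++ u) ∈⟨ q ⟩
    telescope-x̄^ʷ zero u = ∈⟨⟩-resp (≋-sym (-P-self (g u))) 0P-∈⟨⟩
    telescope-x̄^ʷ (suc k) u =
      ∈⟨⟩-resp regroup (-P-∈⟨⟩ (telescope-x̄^ʷ k u) (∈⟨⟩-resp (-P-cong ≋-refl (g-resp x-w≈v)) (step w)))
      where
      v w : Waf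
      v = x̄ ^ʷ k ++ u
      w = x̄ ++ v
      x-w≈v : (x ++ w) ≈W v
      x-w≈v l = trans (act-++ x w l) (trans (cong (act x) (act-++ x̄ v l)) (x-x̄ (act v l)))
      regroup : (g u -P g v) -P (g w -P g v) ≋ g u -P g (x̄ ^ʷ suc k ++ u)
      regroup = ≋-trans (-P-cancelʳ (g u) (g w) (g v)) (-P-cong ≋-refl (≋-reflexive (cong g (sym (++-assoc x̄ (x̄ ^ʷ k) u)))))

    telescope : ∀ j u → g u -P g (zpow x x̄ j ++ u) ∈⟨ q ⟩
    telescope (+ k)    = telescope-^ʷ k
    telescope -[1+ k ] = telescope-x̄^ʷ (suc k)

  -- (s_α t_{α^∨}) s_α = t_{-α^∨}
  tα∨⁻¹ : Fin m → Waf
  tα∨⁻¹ i = (i , + 1) ∷ (i , + 0) ∷ []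

  translation : Fin m → ℤ → Waf
  translation i = zpow (tα∨ i) (tα∨⁻¹ i)

  module _ (i : Fin m) where
    open AffineReflection (root i) (coroot i)

    act-translation : ∀ j l → act (translation i j) l ≡ l +V (j ·V coroot i)
    act-translation (+ k) l =
      trans (act-^ʷ (tα∨ i) (coroot i) (+ 1) (reflect₀∘reflect₁ (pair-two i)) k l) (cong (λ z → l +V (z ·V coroot i)) (ℤ.*-identityʳ (+ k)))
    act-translation -[1+ k ] l =
      trans (act-^ʷ (tα∨⁻¹ i) (coroot i) (- + 1) (reflect₁∘reflect₀ (pair-two i)) (suc k) l) (cong (λ z → l +V (z ·V coroot i)) (times-minus-one (+ suc k)))
      where
      times-minus-one : ∀ z → z * - + 1 ≡ - z
      times-minus-one = solve-∀

    tα∨-tα∨⁻¹ : ∀ l → act (tα∨ i) (act (tα∨⁻¹ i) l) ≡ l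
    tα∨-tα∨⁻¹ l = begin
      act (tα∨ i) (act (tα∨⁻¹ i) l)                           ≡⟨ reflect₀∘reflect₁ (pair-two i) _ ⟩
      act (tα∨⁻¹ i) l +V ((+ 1) ·V coroot i)                  ≡⟨ cong (_+V ((+ 1) ·V coroot i)) (reflect₁∘reflect₀ (pair-two i) l) ⟩
      (l +V ((- + 1) ·V coroot i)) +V ((+ 1) ·V coroot i)     ≡⟨ +V-·V-distrib l (coroot i) (- + 1) (+ 1) ⟩
      l +V ((+ 0) ·V coroot i)                                ≡⟨ +V-0·V l (coroot i) ⟩
      l                                                       ∎
      where open ≡-Reasoning

    sα-translation : ∀ T τ → (∀ l → act T l ≡ l +V τ) →
      (sα i ++ T) ≈W (translation i (- ⟨ root i , τ ⟩) ++ (T ++ sα i))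
    sα-translation T τ act-T l = begin
      reflect (+ 0) (act T l)
        ≡⟨ cong (reflect (+ 0)) (act-T l) ⟩
      reflect (+ 0) (l +V τ)
        ≡⟨ reflect-+V (+ 0) l τ ⟩
      reflect (+ 0) l +V (τ +V ((- (⟨ root i , τ ⟩ + + 0)) ·V coroot i))
        ≡⟨ +V-assoc (reflect (+ 0) l) τ ((- (⟨ root i , τ ⟩ + + 0)) ·V coroot i) ⟨
      (reflect (+ 0) l +V τ) +V ((- (⟨ root i , τ ⟩ + + 0)) ·V coroot i)
        ≡⟨ cong (λ z → (reflect (+ 0) l +V τ) +V ((- z) ·V coroot i)) (ℤ.+-identityʳ ⟨ root i , τ ⟩) ⟩
      (reflect (+ 0) l +V τ) +V ((- ⟨ root i , τ ⟩) ·V coroot i)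
        ≡⟨ cong (_+V ((- ⟨ root i , τ ⟩) ·V coroot i)) (act-T (reflect (+ 0) l)) ⟨
      act T (reflect (+ 0) l) +V ((- ⟨ root i , τ ⟩) ·V coroot i)
        ≡⟨ act-translation (- ⟨ root i , τ ⟩) _ ⟨
      act (translation i (- ⟨ root i , τ ⟩)) (act T (act (sα i) l))
        ≡⟨ cong (act (translation i (- ⟨ root i , τ ⟩))) (act-++ T (sα i) l) ⟨
      act (translation i (- ⟨ root i , τ ⟩)) (act (T ++ sα i) l)
        ≡⟨ act-++ (translation i (- ⟨ root i , τ ⟩)) (T ++ sα i) l ⟨
      act (translation i (- ⟨ root i , τ ⟩) ++ (T ++ sα i)) l
        ∎
      where open ≡-Reasoning

  translationPart : Waf → ZVec n
  translationPart w = act w (Vec.replicate n (+ 0))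

  finitePart⁻¹ : Waf → List (Fin m)
  finitePart⁻¹ []            = []
  finitePart⁻¹ ((j , _) ∷ w) = finitePart⁻¹ w ++ j ∷ []

  -- w = t_τ u with τ = w(0) and u ∈ W, and finitePart⁻¹ w is a word for u⁻¹.
  act-stripFinite : ∀ w l → act (w ++ fromW (finitePart⁻¹ w)) l ≡ l +V translationPart w
  act-stripFinite [] l = sym (+V-identityʳ l)
  act-stripFinite ((j , k) ∷ w) l = begin
    reflect k (act (w ++ fromW (finitePart⁻¹ w ++ j ∷ [])) l)
      ≡⟨ cong (reflect k) strip ⟩
    reflect k (reflect (+ 0) l +V translationPart w)
      ≡⟨ reflect-+V k (reflect (+ 0) l) (translationPart w) ⟩
    reflect (+ 0) (reflect (+ 0) l) +V reflect k (translationPart w)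
      ≡⟨ cong (_+V reflect k (translationPart w)) (reflect-involutive (pair-two j) l) ⟩
    l +V translationPart ((j , k) ∷ w)
      ∎
    where
    open AffineReflection (root j) (coroot j)
    open ≡-Reasoning
    strip : act (w ++ fromW (finitePart⁻¹ w ++ j ∷ [])) l ≡ reflect (+ 0) l +V translationPart w
    strip = begin
      act (w ++ fromW (finitePart⁻¹ w ++ j ∷ [])) l
        ≡⟨ cong (λ z → act z l) (trans (cong (w ++_) (map-++ _ (finitePart⁻¹ w) (j ∷ []))) (sym (++-assoc w _ _))) ⟩
      act ((w ++ fromW (finitePart⁻¹ w)) ++ sα j) l
        ≡⟨ act-++ (w ++ fromW (finitePart⁻¹ w)) (sα j) l ⟩
      act (w ++ fromW (finitePart⁻¹ w)) (reflect (+ 0) l)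
        ≡⟨ act-stripFinite w (reflect (+ 0) l) ⟩
      reflect (+ 0) l +V translationPart w
        ∎

  module _ (f : Waf → Poly n) where

    -- twist Y u is f(Y·u) for the linear extension of f to ℤ[W_af].
    twist : ZWaf → Waf → Poly n
    twist Y u = linExt (λ y → f (y ++ u)) Y

    linExt-1-⟦⟧-*G-⟦⟧ : ∀ x Y → All (λ cy → x ++ proj₂ cy ≡ proj₂ cy ++ x) Y → ∀ u →
      linExt f (((1G -G ⟦ x ⟧) *G Y) *G ⟦ u ⟧) ≋ twist Y u -P twist Y (x ++ u)
    linExt-1-⟦⟧-*G-⟦⟧ x Y commutes u = begin
      linExt f (((1G -G ⟦ x ⟧) *G Y) *G ⟦ u ⟧)
        ≈⟨ linExt-*G-⟦⟧ f ((1G -G ⟦ x ⟧) *G Y) u ⟩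
      linExt (λ p → f (p ++ u)) ((1G -G ⟦ x ⟧) *G Y)
        ≈⟨ linExt-1-⟦⟧-*G (λ p → f (p ++ u)) x Y ⟩
      twist Y u -P linExt (λ z → f ((x ++ z) ++ u)) Y
        ≈⟨ -P-cong ≋-refl (linExt-cong-support Y (All.map (λ {(_ , z)} xz≡zx → ≋-reflexive (cong f (move xz≡zx))) commutes)) ⟩
      twist Y u -P twist Y (x ++ u)
        ∎
      where
      open ≋-Reasoning
      move : ∀ {z} → x ++ z ≡ z ++ x → (x ++ z) ++ u ≡ z ++ (x ++ u)
      move {z} xz≡zx = trans (cong (_++ u) xz≡zx) (++-assoc z x u)

    linExt-*G-1-⟦⟧-*G-⟦⟧ : ∀ Y y w → linExt f ((Y *G (1G -G ⟦ y ⟧)) *G ⟦ w ⟧) ≋ twist Y w -P twist Y (y ++ w)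
    linExt-*G-1-⟦⟧-*G-⟦⟧ Y y w = begin
      linExt f ((Y *G (1G -G ⟦ y ⟧)) *G ⟦ w ⟧)
        ≈⟨ linExt-*G-⟦⟧ f (Y *G (1G -G ⟦ y ⟧)) w ⟩
      linExt (λ p → f (p ++ w)) (Y *G (1G -G ⟦ y ⟧))
        ≈⟨ linExt-*G-1-⟦⟧ (λ p → f (p ++ w)) Y y ⟩
      twist Y w -P linExt (λ z → f ((z ++ y) ++ w)) Y
        ≈⟨ -P-cong ≋-refl (linExt-cong (λ z → ≋-reflexive (cong f (++-assoc z y w))) Y) ⟩
      twist Y w -P twist Y (y ++ w)
        ∎
      where open ≋-Reasoning

  module _ (f : Waf → Poly n) (f-resp : ∀ u v → u ≈W v → f u ≈P f v)
           (f-invariant : ∀ w u → f (w ++ fromW u) ≈P f w) where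

    twist-resp : ∀ Y {u v} → u ≈W v → twist f Y u ≋ twist f Y v
    twist-resp Y u≈v = linExt-cong (λ y → coeffwise (f-resp _ _ (≈W-++ˡ y u≈v))) Y

    twist-invariant : ∀ Y u v → twist f Y (u ++ fromW v) ≋ twist f Y u
    twist-invariant Y u v = linExt-cong (λ y →
      ≋-trans (≋-reflexive (cong f (sym (++-assoc y u (fromW v))))) (coeffwise (f-invariant (y ++ u) v))) Y

    reflection-step : ∀ {q} Y i → (∀ u → twist f Y u -P twist f Y (tα∨ i ++ u) ∈⟨ q ⟩) →
      ∀ w → twist f Y w -P twist f Y (sα i ++ w) ∈⟨ q ⟩
    reflection-step Y i step w =
      ∈⟨⟩-resp (-P-cong (twist-invariant Y w (finitePart⁻¹ w)) conjugate)
               (telescope (twist f Y) (twist-resp Y) (tα∨-tα∨⁻¹ i) step j T)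
      where
      open ≋-Reasoning
      T : Waf
      T = w ++ fromW (finitePart⁻¹ w)
      j : ℤ
      j = - ⟨ root i , translationPart w ⟩
      conjugate : twist f Y (translation i j ++ T) ≋ twist f Y (sα i ++ w)
      conjugate = begin
        twist f Y (translation i j ++ T)
          ≈⟨ twist-invariant Y (translation i j ++ T) (i ∷ []) ⟨
        twist f Y ((translation i j ++ T) ++ sα i)
          ≡⟨ cong (twist f Y) (++-assoc (translation i j) T (sα i)) ⟩
        twist f Y (translation i j ++ (T ++ sα i))
          ≈⟨ twist-resp Y (sα-translation i T (translationPart w) (act-stripFinite w)) ⟨
        twist f Y (sα i ++ T)
          ≈⟨ twist-invariant Y (sα i ++ w) (finitePart⁻¹ w) ⟩
        twist f Y (sα i ++ w)
          ∎

lemma4p2 : ∀ {n m} (R : RootDatum n m) → Irreducible R →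
    let open WithDatum R in
    (f : Waf → Poly n) →
    (∀ u v → u ≈W v → f u ≈P f v) →
    (∀ (i : Fin m) (k : ℤ) (w : Waf) → (f (sα-tk i k ++ w) -P f w) ∈ α̂ i S) →
    (∀ (d : ℕ) → 1 ≤ d → ∀ (w : Waf) (i : Fin m) →
      linExt f (((1G -G ⟦ tα∨ i ⟧) ^G d) *G ⟦ w ⟧) ∈ (α̂ i ^P d) S) →
    (∀ (w : Waf) (u : List (Fin m)) → f (w ++ fromW u) ≈P f w) →
    ∀ (d : ℕ) → 1 ≤ d → ∀ (w : Waf) (i : Fin m) →
      linExt f ((((1G -G ⟦ tα∨ i ⟧) ^G (d ∸ 1)) *G (1G -G ⟦ sα i ⟧)) *G ⟦ w ⟧)
        ∈ (α̂ i ^P d) S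
lemma4p2 R _ f f-resp _ divisible invariant zero () w i
lemma4p2 R _ f f-resp _ divisible invariant (suc d) _ w i =
  membership (∈⟨⟩-resp (≋-sym (linExt-*G-1-⟦⟧-*G-⟦⟧ R f Y (sα i) w))
    (reflection-step R f f-resp invariant Y i step w))
  where
  open WithDatum R
  Y : ZWaf
  Y = (1G -G ⟦ tα∨ i ⟧) ^G d
  step : ∀ u → twist R f Y u -P twist R f Y (tα∨ i ++ u) ∈⟨ α̂ i ^P suc d ⟩
  step u = ∈⟨⟩-resp (linExt-1-⟦⟧-*G-⟦⟧ R f (tα∨ i) Y (^G-commutes R (tα∨ i) d) u)
                    (inIdeal (divisible (suc d) (s≤s ℕ.z≤n) u i))
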